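{- Let $E,E'\in\mathcal P^e$ with $E\xrightarrow{\mu}E'$, and let $\langle r,m\rangle\in top(E)$. If $\langle r,m\rangle\in lab(E')$ then $\langle r,m\rangle\in top(E')$.
   Context: Unlabeled processes. Let $\mathcal N$ be an infinite set of names. The set $\mathcal P$ of processes is generated by $P::=0\mid x(y).P\mid \bar xy.P\mid P\,|\,P\mid(\nu x)P\mid\, !P$; binders, $fn$, $bn$, $n(\cdot)$ as usual (alpha-conversion assumed). Actions $\mu$: $xy$, $\bar xy$, $\bar x(y)$, $\tau$, with $bn(\bar x(y))=\{y\}$, otherwise empty, $fn(xy)=fn(\bar xy)=\{x,y\}$, $fn(\bar x(y))=\{x\}$, $fn(\tau)=\emptyset$. The (early) transition relation is the least relation closed under: Input $x(y).P\xrightarrow{xz}P\{z/y\}$; Output $\bar xy.P\xrightarrow{\bar xy}P$; Open: $P\xrightarrow{\bar xy}P'$, $x\ne y$ imply $(\nu y)P\xrightarrow{\bar x(y)}P'$; Res: $P\xrightarrow{\mu}P'$, $y\notin n(\mu)$ imply $(\nu y)P\xrightarrow{\mu}(\nu y)P'$; Par: $P\xrightarrow{\mu}P'$, $bn(\mu)\cap fn(Q)=\emptyset$ imply $P|Q\xrightarrow{\mu}P'|Q$; Com: $P\xrightarrow{xy}P'$, $Q\xrightarrow{\bar xy}Q'$ imply $P|Q\xrightarrow{\tau}P'|Q'$; Close: $P\xrightarrow{xy}P'$, $Q\xrightarrow{\bar x(y)}Q'$, $y\notin fn(P)$ imply $P|Q\xrightarrow{\tau}(\nu y)(P'|Q')$;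 symmetric versions of Par, Com, Close; Rep: $P\xrightarrow{\mu}P'$ implies $!P\xrightarrow{\mu}P'|!P$. Labeled terms. Labels are pairs $\langle s,n\rangle\in\{0,1\}^*\times\mathbb N$; $s_0\sqsubseteq s_1$ means $s_0$ is a prefix of $s_1$; for label sets, $L_0\,\Re\,L_1$ iff for all $\langle s_0,n_0\rangle\in L_0$, $\langle s_1,n_1\rangle\in L_1$: $s_0\not\sqsubseteq s_1$ and $s_1\not\sqsubseteq s_0$. Ground labeled terms $\mathcal P^e_{gr}$: $E::=0\mid \mu_{\langle s,n\rangle}.E\mid(\nu x)E\mid E\,|\,E\mid\, !_{\langle s,n\rangle}P$, with $\mu$ a prefix $x(y)$ or $\bar xy$ and $P\in\mathcal P$ unlabeled. Labeling function: $L_{\langle s,n\rangle}(0)=0$; $L_{\langle s,n\rangle}(\mu.P)=\mu_{\langle s,n\rangle}.L_{\langle s,n+1\rangle}(P)$; $L_{\langle s,n\rangle}(P_0|P_1)=L_{\langle s0,n\rangle}(P_0)\,|\,L_{\langle s1,n\rangle}(P_1)$; $L_{\langle s,n\rangle}((\nu x)P)=(\nu x)L_{\langle s,n\rangle}(P)$; $L_{\langle s,n\rangle}(!P)=\,!_{\langle s,n\rangle}P$. $top(0)=lab(0)=\emptyset$; $top(\mu_v.E)=\{v\}$, $lab(\mu_v.E)=\{v\}\cup lab(E)$; $top,lab$ of $(\nu x)E$ equal those of $E$; $top(E_0|E_1)=top(E_0)\cup top(E_1)$, $lab(E_0|E_1)=lab(E_0)\cup lab(E_1)$; $top(!_vP)=lab(!_vP)=\{v\}$.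 $wf$ is the least predicate with: $wf(0)$; $wf(L_{\langle s,n\rangle}(\mu.P))$ for every $\mu.P\in\mathcal P$ and label; $wf(E_0|E_1)$ if $wf(E_0)$, $wf(E_1)$, $top(E_0)\,\Re\,top(E_1)$; $wf((\nu x)E)$ if $wf(E)$; $wf(!_{\langle s,n\rangle}P)$ for every $P\in\mathcal P$ and label. $\mathcal P^e=\{E\in\mathcal P^e_{gr}:wf(E)\}$. Labeled transitions use the unlabeled rules with labels ignored (e.g. $x(y)_v.E\xrightarrow{xz}E\{z/y\}$, substitution not affecting labels; $\bar xy_v.E\xrightarrow{\bar xy}E$), except replication: if $P\xrightarrow{\mu}P'$ (unlabeled) then $!_{\langle s,n\rangle}P\xrightarrow{\mu}L_{\langle s0,n+1\rangle}(P')\,|\,!_{\langle s1,n+1\rangle}P$. -}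

module Defs where

open import Data.Nat using (ℕ; zero; suc)
open import Data.Bool using (Bool; true; false)
open import Data.List using (List; []; _∷_; _++_; _∷ʳ_)
open import Data.List.Membership.Propositional using (_∈_)
open import Data.Product using (_×_; _,_; ∃; proj₁)
open import Relation.Binary.PropositionalEquality using (_≡_)
open import Relation.Nullary using (¬_)

-- Names: de Bruijn indices over ℕ (the infinite name set 𝒩 with
-- alpha-conversion built in).  A binder (input object, restriction,
-- bound output object) binds index 0 in its scope.

Name : Set
Name = ℕ

Ren : Set
Ren = Name → Name

ext : Ren → Ren
ext ρ zero    = zero
ext ρ (suc i) = suc (ρ i)

sub0 : Name → Ren
sub0 z zero    = z
sub0 z (suc i) = i

swap01 : Ren
swap01 zero          = suc zero
swap01 (suc zero)    = zero
swap01 (suc (suc i)) = suc (suc i)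

-- Unlabeled processes
--   𝟎 | x(y).P  (inp x P, y bound as 0) | x̄y.P | P ∣ Q | (ν x)P | !P

data Proc : Set where
  𝟎    : Proc
  inp  : Name → Proc → Proc
  out  : Name → Name → Proc → Proc
  _∣_  : Proc → Proc → Proc
  ν    : Proc → Proc
  !_   : Proc → Proc

renP : Ren → Proc → Proc
renP ρ 𝟎         = 𝟎
renP ρ (inp x P) = inp (ρ x) (renP (ext ρ) P)
renP ρ (out x y P) = out (ρ x) (ρ y) (renP ρ P)
renP ρ (P ∣ Q)   = renP ρ P ∣ renP ρ Q
renP ρ (ν P)     = ν (renP (ext ρ) P)
renP ρ (! P)     = ! renP ρ P

-- Actions: xy (input), x̄y (output), x̄(y) (bound output; y is bound
-- and becomes index 0 of the residual), τ.

data Act : Set where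
  inpA  : Name → Name → Act
  outA  : Name → Name → Act
  boutA : Name → Act
  τ     : Act

-- weakening of a parallel component / the replicated process when the
-- action binds a (fresh) name: encodes bn(μ) ∩ fn(Q) = ∅ via alpha.
wkP : Act → Proc → Proc
wkP (boutA _) P = renP suc P
wkP _         P = P

infix 4 _—P[_]→_

data _—P[_]→_ : Proc → Act → Proc → Set where
  inputR  : ∀ {x z P} → inp x P —P[ inpA x z ]→ renP (sub0 z) P
  outputR : ∀ {x y P} → out x y P —P[ outA x y ]→ P
  -- Open: P --x̄y--> P', y the restricted name (index 0), x ≠ y
  openR   : ∀ {x P P'} → P —P[ outA (suc x) zero ]→ P' → ν P —P[ boutA x ]→ P'
  -- Res: y ∉ n(μ)
  resInp  : ∀ {x y P P'} → P —P[ inpA (suc x) (suc y) ]→ P' → ν P —P[ inpA x y ]→ ν P'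
  resOut  : ∀ {x y P P'} → P —P[ outA (suc x) (suc y) ]→ P' → ν P —P[ outA x y ]→ ν P'
  resBout : ∀ {x P P'} → P —P[ boutA (suc x) ]→ P' → ν P —P[ boutA x ]→ ν (renP swap01 P')
  resTau  : ∀ {P P'} → P —P[ τ ]→ P' → ν P —P[ τ ]→ ν P'
  parL    : ∀ {μ P P' Q} → P —P[ μ ]→ P' → P ∣ Q —P[ μ ]→ P' ∣ wkP μ Q
  parR    : ∀ {μ P Q Q'} → Q —P[ μ ]→ Q' → P ∣ Q —P[ μ ]→ wkP μ P ∣ Q'
  comL    : ∀ {x y P P' Q Q'} → P —P[ inpA x y ]→ P' → Q —P[ outA x y ]→ Q' →
            P ∣ Q —P[ τ ]→ P' ∣ Q'
  comR    : ∀ {x y P P' Q Q'} → P —P[ outA x y ]→ P' → Q —P[ inpA x y ]→ Q' →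
            P ∣ Q —P[ τ ]→ P' ∣ Q'
  -- Close: P receives the fresh extruded name (index 0 after weakening P)
  closeL  : ∀ {x P P' Q Q'} → renP suc P —P[ inpA (suc x) zero ]→ P' → Q —P[ boutA x ]→ Q' →
            P ∣ Q —P[ τ ]→ ν (P' ∣ Q')
  closeR  : ∀ {x P P' Q Q'} → P —P[ boutA x ]→ P' → renP suc Q —P[ inpA (suc x) zero ]→ Q' →
            P ∣ Q —P[ τ ]→ ν (P' ∣ Q')
  repR    : ∀ {μ P P'} → P —P[ μ ]→ P' → ! P —P[ μ ]→ P' ∣ wkP μ (! P)

-- Labels ⟨s,n⟩ ∈ {0,1}* × ℕ  (false = 0, true = 1)

Label : Set
Label = List Bool × ℕ

_⊑_ : List Bool → List Bool → Set
s₀ ⊑ s₁ = ∃ λ u → s₀ ++ u ≡ s₁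

_ℜ_ : List Label → List Label → Set
L₀ ℜ L₁ = ∀ {v₀ v₁} → v₀ ∈ L₀ → v₁ ∈ L₁ →
          ¬ (proj₁ v₀ ⊑ proj₁ v₁) × ¬ (proj₁ v₁ ⊑ proj₁ v₀)

data LTerm : Set where
  𝟎ₗ   : LTerm
  inpₗ : Name → Label → LTerm → LTerm
  outₗ : Name → Name → Label → LTerm → LTerm
  _∣ₗ_ : LTerm → LTerm → LTerm
  νₗ   : LTerm → LTerm
  !ₗ   : Label → Proc → LTerm

renE : Ren → LTerm → LTerm
renE ρ 𝟎ₗ           = 𝟎ₗ
renE ρ (inpₗ x v E) = inpₗ (ρ x) v (renE (ext ρ) E)
renE ρ (outₗ x y v E) = outₗ (ρ x) (ρ y) v (renE ρ E)
renE ρ (E ∣ₗ F)     = renE ρ E ∣ₗ renE ρ F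
renE ρ (νₗ E)       = νₗ (renE (ext ρ) E)
renE ρ (!ₗ v P)     = !ₗ v (renP ρ P)

wkE : Act → LTerm → LTerm
wkE (boutA _) E = renE suc E
wkE _         E = E

lbl : Label → Proc → LTerm
lbl (s , n) 𝟎         = 𝟎ₗ
lbl (s , n) (inp x P) = inpₗ x (s , n) (lbl (s , suc n) P)
lbl (s , n) (out x y P) = outₗ x y (s , n) (lbl (s , suc n) P)
lbl (s , n) (P ∣ Q)   = lbl (s ∷ʳ false , n) P ∣ₗ lbl (s ∷ʳ true , n) Q
lbl (s , n) (ν P)     = νₗ (lbl (s , n) P)
lbl (s , n) (! P)     = !ₗ (s , n) P

top : LTerm → List Label
top 𝟎ₗ             = []
top (inpₗ x v E)   = v ∷ []
top (outₗ x y v E) = v ∷ []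
top (E ∣ₗ F)       = top E ++ top F
top (νₗ E)         = top E
top (!ₗ v P)       = v ∷ []

lab : LTerm → List Label
lab 𝟎ₗ             = []
lab (inpₗ x v E)   = v ∷ lab E
lab (outₗ x y v E) = v ∷ lab E
lab (E ∣ₗ F)       = lab E ++ lab F
lab (νₗ E)         = lab E
lab (!ₗ v P)       = v ∷ []

data wf : LTerm → Set where
  wf-𝟎   : wf 𝟎ₗ
  wf-inp : ∀ x P v → wf (lbl v (inp x P))
  wf-out : ∀ x y P v → wf (lbl v (out x y P))
  wf-par : ∀ {E₀ E₁} → wf E₀ → wf E₁ → top E₀ ℜ top E₁ → wf (E₀ ∣ₗ E₁)
  wf-ν   : ∀ {E} → wf E → wf (νₗ E)
  wf-!   : ∀ v P → wf (!ₗ v P)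

infix 4 _—[_]→_

data _—[_]→_ : LTerm → Act → LTerm → Set where
  inputR  : ∀ {x z v E} → inpₗ x v E —[ inpA x z ]→ renE (sub0 z) E
  outputR : ∀ {x y v E} → outₗ x y v E —[ outA x y ]→ E
  openR   : ∀ {x E E'} → E —[ outA (suc x) zero ]→ E' → νₗ E —[ boutA x ]→ E'
  resInp  : ∀ {x y E E'} → E —[ inpA (suc x) (suc y) ]→ E' → νₗ E —[ inpA x y ]→ νₗ E'
  resOut  : ∀ {x y E E'} → E —[ outA (suc x) (suc y) ]→ E' → νₗ E —[ outA x y ]→ νₗ E'
  resBout : ∀ {x E E'} → E —[ boutA (suc x) ]→ E' → νₗ E —[ boutA x ]→ νₗ (renE swap01 E')
  resTau  : ∀ {E E'} → E —[ τ ]→ E' → νₗ E —[ τ ]→ νₗ E'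
  parL    : ∀ {μ E E' F} → E —[ μ ]→ E' → E ∣ₗ F —[ μ ]→ E' ∣ₗ wkE μ F
  parR    : ∀ {μ E F F'} → F —[ μ ]→ F' → E ∣ₗ F —[ μ ]→ wkE μ E ∣ₗ F'
  comL    : ∀ {x y E E' F F'} → E —[ inpA x y ]→ E' → F —[ outA x y ]→ F' →
            E ∣ₗ F —[ τ ]→ E' ∣ₗ F'
  comR    : ∀ {x y E E' F F'} → E —[ outA x y ]→ E' → F —[ inpA x y ]→ F' →
            E ∣ₗ F —[ τ ]→ E' ∣ₗ F'
  closeL  : ∀ {x E E' F F'} → renE suc E —[ inpA (suc x) zero ]→ E' → F —[ boutA x ]→ F' →
            E ∣ₗ F —[ τ ]→ νₗ (E' ∣ₗ F')
  closeR  : ∀ {x E E' F F'} → E —[ boutA x ]→ E' → renE suc F —[ inpA (suc x) zero ]→ F' →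
            E ∣ₗ F —[ τ ]→ νₗ (E' ∣ₗ F')
  repR    : ∀ {μ s n P P'} → P —P[ μ ]→ P' →
            !ₗ (s , n) P —[ μ ]→ lbl (s ∷ʳ false , suc n) P' ∣ₗ !ₗ (s ∷ʳ true , suc n) (wkP μ P)

module Submission where

-- In a well-formed term every label extends, in the prefix order on strings, some top-level label,
-- and the top-level labels of the two sides of a parallel composition are incomparable.  A transition
-- only produces labels extending labels of its source, so a top-level label of one parallel component
-- cannot reappear in the other.  In the component that fires, the consumed prefix or replication
-- ⟨s,n⟩ is replaced by labels of counter at least n+1, so a surviving top-level label stays on top.

open import Defs
open import Data.Nat using (ℕ; suc; _≤_)
open import Data.Nat.Properties using (≤-refl; ≤-trans; n≤1+n; 1+n≰n)
open import Data.Bool using (Bool; true; false)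
open import Data.List using (List; []; _∷_; _++_; _∷ʳ_)
open import Data.List.Properties using (++-assoc; ++-identityʳ)
open import Data.List.Membership.Propositional using (_∈_; _∉_; find; lose)
open import Data.List.Membership.Propositional.Properties using (∈-++⁺ˡ; ∈-++⁺ʳ; ∈-++⁻)
open import Data.List.Relation.Unary.Any using (Any; here; there; map)
open import Data.List.Relation.Unary.Any.Properties using (++⁺ˡ; ++⁺ʳ)
open import Data.Product using (_×_; _,_; proj₁; proj₂; swap)
open import Data.Sum using (inj₁; inj₂; [_,_]′)
open import Data.Empty using (⊥-elim)
open import Function using (_∘_)
open import Relation.Binary.PropositionalEquality using (_≡_; refl; sym; cong; cong₂; subst; subst₂)

⊑-refl : ∀ s → s ⊑ s
⊑-refl s = [] , ++-identityʳ s

⊑-trans : ∀ {s₀ s₁ s₂} → s₀ ⊑ s₁ → s₁ ⊑ s₂ → s₀ ⊑ s₂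
⊑-trans {s₀} (u , refl) (w , refl) = u ++ w , sym (++-assoc s₀ u w)

⊑-∷ʳ : ∀ s b → s ⊑ (s ∷ʳ b)
⊑-∷ʳ s b = b ∷ [] , refl

ℜ-sym : ∀ {L₀ L₁} → L₀ ℜ L₁ → L₁ ℜ L₀
ℜ-sym r v₁∈ v₀∈ = swap (r v₀∈ v₁∈)

infix 4 _⊴_

_⊴_ : List Label → List Label → Set
L ⊴ M = ∀ {t} → t ∈ L → Any (λ u → proj₁ u ⊑ proj₁ t) M

⊴-refl : ∀ {L} → L ⊴ L
⊴-refl {t = t} t∈ = lose t∈ (⊑-refl (proj₁ t))

⊴-reflexive : ∀ {L M} → L ≡ M → L ⊴ M
⊴-reflexive refl = ⊴-refl

⊴-trans : ∀ {L M N} → L ⊴ M → M ⊴ N → L ⊴ N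
⊴-trans L⊴M M⊴N t∈ with find (L⊴M t∈)
... | u , u∈ , u⊑t = map (λ w⊑u → ⊑-trans w⊑u u⊑t) (M⊴N u∈)

⊴-there : ∀ {L M} v → L ⊴ M → L ⊴ v ∷ M
⊴-there v L⊴M = there ∘ L⊴M

⊴-++ : ∀ {L₀ L₁ M₀ M₁} → L₀ ⊴ M₀ → L₁ ⊴ M₁ → L₀ ++ L₁ ⊴ M₀ ++ M₁
⊴-++ {L₀} {M₀ = M₀} L₀⊴M₀ L₁⊴M₁ t∈ = [ ++⁺ˡ ∘ L₀⊴M₀ , ++⁺ʳ M₀ ∘ L₁⊴M₁ ]′ (∈-++⁻ L₀ t∈)

⊴-ℜ⇒∉ : ∀ {L M₀ M₁ v} → L ⊴ M₁ → M₀ ℜ M₁ → v ∈ M₀ → v ∉ L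
⊴-ℜ⇒∉ L⊴M₁ r v∈M₀ v∈L with find (L⊴M₁ v∈L)
... | u , u∈M₁ , u⊑v = proj₂ (r v∈M₀ u∈M₁) u⊑v

lab-lbl : ∀ {s n t} P → t ∈ lab (lbl (s , n) P) → s ⊑ proj₁ t × n ≤ proj₂ t
lab-lbl {s} (inp x P) (here refl) = ⊑-refl s , ≤-refl
lab-lbl {n = n} (inp x P) (there t∈) with lab-lbl P t∈
... | s⊑ , 1+n≤ = s⊑ , ≤-trans (n≤1+n n) 1+n≤
lab-lbl {s} (out x y P) (here refl) = ⊑-refl s , ≤-refl
lab-lbl {n = n} (out x y P) (there t∈) with lab-lbl P t∈
... | s⊑ , 1+n≤ = s⊑ , ≤-trans (n≤1+n n) 1+n≤
lab-lbl {s} (P ∣ Q) t∈ with ∈-++⁻ (lab (lbl (s ∷ʳ false , _) P)) t∈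
... | inj₁ t∈P = let s⊑ , n≤ = lab-lbl P t∈P in ⊑-trans (⊑-∷ʳ s false) s⊑ , n≤
... | inj₂ t∈Q = let s⊑ , n≤ = lab-lbl Q t∈Q in ⊑-trans (⊑-∷ʳ s true) s⊑ , n≤
lab-lbl (ν P) t∈ = lab-lbl P t∈
lab-lbl {s} (! P) (here refl) = ⊑-refl s , ≤-refl

lab-lbl-fresh : ∀ {s s' n} P → (s , n) ∉ lab (lbl (s' , suc n) P)
lab-lbl-fresh P v∈ = 1+n≰n (proj₂ (lab-lbl P v∈))

lab-lbl-⊴ : ∀ {s n} P → lab (lbl (s , suc n) P) ⊴ (s , n) ∷ []
lab-lbl-⊴ P t∈ = here (proj₁ (lab-lbl P t∈))

lab-renE : ∀ ρ E → lab (renE ρ E) ≡ lab E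
lab-renE ρ 𝟎ₗ             = refl
lab-renE ρ (inpₗ x v E)   = cong (v ∷_) (lab-renE (ext ρ) E)
lab-renE ρ (outₗ x y v E) = cong (v ∷_) (lab-renE ρ E)
lab-renE ρ (E ∣ₗ F)       = cong₂ _++_ (lab-renE ρ E) (lab-renE ρ F)
lab-renE ρ (νₗ E)         = lab-renE (ext ρ) E
lab-renE ρ (!ₗ v P)       = refl

top-renE : ∀ ρ E → top (renE ρ E) ≡ top E
top-renE ρ 𝟎ₗ             = refl
top-renE ρ (inpₗ x v E)   = refl
top-renE ρ (outₗ x y v E) = refl
top-renE ρ (E ∣ₗ F)       = cong₂ _++_ (top-renE ρ E) (top-renE ρ F)
top-renE ρ (νₗ E)         = top-renE (ext ρ) E
top-renE ρ (!ₗ v P)       = refl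

lab-wkE : ∀ μ E → lab (wkE μ E) ≡ lab E
lab-wkE (inpA _ _) E = refl
lab-wkE (outA _ _) E = refl
lab-wkE (boutA _)  E = lab-renE suc E
lab-wkE τ          E = refl

top-wkE : ∀ μ E → top (wkE μ E) ≡ top E
top-wkE (inpA _ _) E = refl
top-wkE (outA _ _) E = refl
top-wkE (boutA _)  E = top-renE suc E
top-wkE τ          E = refl

renE-lbl : ∀ ρ v P → renE ρ (lbl v P) ≡ lbl v (renP ρ P)
renE-lbl ρ v       𝟎           = refl
renE-lbl ρ (s , n) (inp x P)   = cong (inpₗ (ρ x) (s , n)) (renE-lbl (ext ρ) (s , suc n) P)
renE-lbl ρ (s , n) (out x y P) = cong (outₗ (ρ x) (ρ y) (s , n)) (renE-lbl ρ (s , suc n) P)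
renE-lbl ρ (s , n) (P ∣ Q)     =
  cong₂ _∣ₗ_ (renE-lbl ρ (s ∷ʳ false , n) P) (renE-lbl ρ (s ∷ʳ true , n) Q)
renE-lbl ρ v       (ν P)       = cong νₗ (renE-lbl (ext ρ) v P)
renE-lbl ρ (s , n) (! P)       = refl

wf-renE : ∀ ρ {E} → wf E → wf (renE ρ E)
wf-renE ρ wf-𝟎               = wf-𝟎
wf-renE ρ (wf-inp x P v)     = subst wf (sym (renE-lbl ρ v (inp x P))) (wf-inp (ρ x) _ v)
wf-renE ρ (wf-out x y P v)   = subst wf (sym (renE-lbl ρ v (out x y P))) (wf-out (ρ x) (ρ y) _ v)
wf-renE ρ (wf-par {E₀} {E₁} w₀ w₁ r) =
  wf-par (wf-renE ρ w₀) (wf-renE ρ w₁)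
    (subst₂ _ℜ_ (sym (top-renE ρ E₀)) (sym (top-renE ρ E₁)) r)
wf-renE ρ (wf-ν w)           = wf-ν (wf-renE (ext ρ) w)
wf-renE ρ (wf-! v P)         = wf-! v (renP ρ P)

lab-⊴-top : ∀ {E} → wf E → lab E ⊴ top E
lab-⊴-top wf-𝟎                   ()
lab-⊴-top (wf-inp x P (s , n))   t∈ = here (proj₁ (lab-lbl (inp x P) t∈))
lab-⊴-top (wf-out x y P (s , n)) t∈ = here (proj₁ (lab-lbl (out x y P) t∈))
lab-⊴-top (wf-par w₀ w₁ _)       t∈ = ⊴-++ (lab-⊴-top w₀) (lab-⊴-top w₁) t∈
lab-⊴-top (wf-ν w)               t∈ = lab-⊴-top w t∈
lab-⊴-top (wf-! (s , n) P)       t∈ = here (proj₁ (lab-lbl (! P) t∈))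

lab-step-⊴ : ∀ {E μ E'} → E —[ μ ]→ E' → lab E' ⊴ lab E
lab-step-⊴ {inpₗ x v E} (inputR {z = z}) = ⊴-there v (⊴-reflexive (lab-renE (sub0 z) E))
lab-step-⊴ {outₗ x y v E} outputR        = ⊴-there v ⊴-refl
lab-step-⊴ (openR tr)                    = lab-step-⊴ tr
lab-step-⊴ (resInp tr)                   = lab-step-⊴ tr
lab-step-⊴ (resOut tr)                   = lab-step-⊴ tr
lab-step-⊴ (resBout {E' = E'} tr)        = ⊴-trans (⊴-reflexive (lab-renE swap01 E')) (lab-step-⊴ tr)
lab-step-⊴ (resTau tr)                   = lab-step-⊴ tr
lab-step-⊴ {_ ∣ₗ F} {μ} (parL tr)        = ⊴-++ (lab-step-⊴ tr) (⊴-reflexive (lab-wkE μ F))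
lab-step-⊴ {E ∣ₗ _} {μ} (parR tr)        = ⊴-++ (⊴-reflexive (lab-wkE μ E)) (lab-step-⊴ tr)
lab-step-⊴ (comL tr tr')                 = ⊴-++ (lab-step-⊴ tr) (lab-step-⊴ tr')
lab-step-⊴ (comR tr tr')                 = ⊴-++ (lab-step-⊴ tr) (lab-step-⊴ tr')
lab-step-⊴ {E ∣ₗ _} (closeL tr tr')      =
  ⊴-++ (⊴-trans (lab-step-⊴ tr) (⊴-reflexive (lab-renE suc E))) (lab-step-⊴ tr')
lab-step-⊴ {_ ∣ₗ F} (closeR tr tr')      =
  ⊴-++ (lab-step-⊴ tr) (⊴-trans (lab-step-⊴ tr') (⊴-reflexive (lab-renE suc F)))
-- The residual L_⟨s0,n+1⟩(P') | !_⟨s1,n+1⟩ P of replication is definitionally L_⟨s,n+1⟩(P' | !P).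
lab-step-⊴ (repR {μ = μ} {P = P} {P'} _) = lab-lbl-⊴ (P' ∣ (! wkP μ P))

TopPreserved : LTerm → LTerm → Set
TopPreserved E E' = ∀ {v} → v ∈ top E → v ∈ lab E' → v ∈ top E'

wkE-TopPreserved : ∀ μ E → TopPreserved E (wkE μ E)
wkE-TopPreserved μ E v∈ _ = subst (_ ∈_) (sym (top-wkE μ E)) v∈

TopPreserved-∣ : ∀ {E E' F F'} → wf E → wf F → top E ℜ top F →
                 lab E' ⊴ lab E → lab F' ⊴ lab F →
                 TopPreserved E E' → TopPreserved F F' → TopPreserved (E ∣ₗ F) (E' ∣ₗ F')
TopPreserved-∣ {E} {E'} wE wF r E'⊴E F'⊴F keepE keepF v∈top v∈lab
  with ∈-++⁻ (top E) v∈top | ∈-++⁻ (lab E') v∈lab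
... | inj₁ v∈E | inj₁ v∈E' = ∈-++⁺ˡ (keepE v∈E v∈E')
... | inj₂ v∈F | inj₂ v∈F' = ∈-++⁺ʳ (top E') (keepF v∈F v∈F')
... | inj₁ v∈E | inj₂ v∈F' =
  ⊥-elim (⊴-ℜ⇒∉ (⊴-trans F'⊴F (lab-⊴-top wF)) r v∈E v∈F')
... | inj₂ v∈F | inj₁ v∈E' =
  ⊥-elim (⊴-ℜ⇒∉ (⊴-trans E'⊴E (lab-⊴-top wE)) (ℜ-sym r) v∈F v∈E')

top-preserved : ∀ {E μ E'} → wf E → E —[ μ ]→ E' → TopPreserved E E'
top-preserved (wf-inp x P (s , n)) (inputR {z = z}) (here refl) v∈ =
  ⊥-elim (lab-lbl-fresh P (subst (_ ∈_) (lab-renE (sub0 z) (lbl (s , suc n) P)) v∈))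
top-preserved (wf-out x y P (s , n)) outputR (here refl) v∈ = ⊥-elim (lab-lbl-fresh P v∈)
top-preserved (wf-ν w) (openR tr) = top-preserved w tr
top-preserved (wf-ν w) (resInp tr) = top-preserved w tr
top-preserved (wf-ν w) (resOut tr) = top-preserved w tr
top-preserved (wf-ν w) (resBout {E' = E'} tr) v∈top v∈lab =
  subst (_ ∈_) (sym (top-renE swap01 E'))
    (top-preserved w tr v∈top (subst (_ ∈_) (lab-renE swap01 E') v∈lab))
top-preserved (wf-ν w) (resTau tr) = top-preserved w tr
top-preserved {_ ∣ₗ F} {μ} (wf-par w₀ w₁ r) (parL {E' = E'} tr) =
  TopPreserved-∣ {E' = E'} {F' = wkE μ F} w₀ w₁ r (lab-step-⊴ tr) (⊴-reflexive (lab-wkE μ F))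
    (top-preserved w₀ tr) (wkE-TopPreserved μ F)
top-preserved {E ∣ₗ _} {μ} (wf-par w₀ w₁ r) (parR {F' = F'} tr) =
  TopPreserved-∣ {E' = wkE μ E} {F' = F'} w₀ w₁ r (⊴-reflexive (lab-wkE μ E)) (lab-step-⊴ tr)
    (wkE-TopPreserved μ E) (top-preserved w₁ tr)
top-preserved (wf-par w₀ w₁ r) (comL {E' = E'} {F' = F'} tr tr') =
  TopPreserved-∣ {E' = E'} {F' = F'} w₀ w₁ r (lab-step-⊴ tr) (lab-step-⊴ tr')
    (top-preserved w₀ tr) (top-preserved w₁ tr')
top-preserved (wf-par w₀ w₁ r) (comR {E' = E'} {F' = F'} tr tr') =
  TopPreserved-∣ {E' = E'} {F' = F'} w₀ w₁ r (lab-step-⊴ tr) (lab-step-⊴ tr')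
    (top-preserved w₀ tr) (top-preserved w₁ tr')
top-preserved {E ∣ₗ _} (wf-par w₀ w₁ r) (closeL {E' = E'} {F' = F'} tr tr') =
  TopPreserved-∣ {E' = E'} {F' = F'} w₀ w₁ r
    (⊴-trans (lab-step-⊴ tr) (⊴-reflexive (lab-renE suc E))) (lab-step-⊴ tr')
    (top-preserved (wf-renE suc w₀) tr ∘ subst (_ ∈_) (sym (top-renE suc E)))
    (top-preserved w₁ tr')
top-preserved {_ ∣ₗ F} (wf-par w₀ w₁ r) (closeR {E' = E'} {F' = F'} tr tr') =
  TopPreserved-∣ {E' = E'} {F' = F'} w₀ w₁ r
    (lab-step-⊴ tr) (⊴-trans (lab-step-⊴ tr') (⊴-reflexive (lab-renE suc F)))
    (top-preserved w₀ tr)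
    (top-preserved (wf-renE suc w₁) tr' ∘ subst (_ ∈_) (sym (top-renE suc F)))
top-preserved (wf-! (s , n) P) (repR {μ = μ} {P' = P'} _) (here refl) v∈ =
  ⊥-elim (lab-lbl-fresh (P' ∣ (! wkP μ P)) v∈)

lemmaA8 : ∀ (E E' : LTerm) (μ : Act) (r : List Bool) (m : ℕ) →
    wf E → wf E' → E —[ μ ]→ E' →
    (r , m) ∈ top E → (r , m) ∈ lab E' → (r , m) ∈ top E'
lemmaA8 E E' μ r m wfE _ tr = top-preserved wfE tr
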